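{- For every integer $n \ge 2$, $t(n) \le n-2$.
   Context: A cyclic permutation of order $n$ is a bijective labeling of the vertices of a cycle of length $n$ by the elements of $[n]$, up to rotation of the cycle (reflections are not identified). A swap exchanges the labels of any two (not necessarily adjacent) vertices. $t(n)$ is the maximum, over all cyclic permutations of order $n$, of the minimum number of swaps needed to transform it into the trivial cyclic permutation $(1,2,\ldots,n)$ (labels $1,\ldots,n$ consecutively in order around the cycle). Equivalently, with $c=(1,2,\ldots,n)\in S_n$, $C_n=\langle c\rangle$ and $\operatorname{cyc}(\sigma)$ the number of cycles of $\sigma\in S_n$ (fixed points included), $t(n)=\max_{\pi\in S_n}\min_{\sigma\in\pi C_n}(n-\operatorname{cyc}(\sigma))$. -}

module Defs where

open import Data.Nat using (ℕ; zero; suc; _+_; _∸_; _≤ᵇ_)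
open import Data.Nat.DivMod using (_mod_)
open import Data.Fin using (Fin; toℕ)
open import Data.Bool using (Bool; if_then_else_)
open import Data.List using (List; upTo; allFin; map)
open import Data.Nat.ListAction using (sum)
open import Data.Bool.ListAction using (all)
open import Data.Fin.Permutation using (Permutation′; _⟨$⟩ʳ_)

iter : {A : Set} → (A → A) → ℕ → A → A
iter f zero    x = x
iter f (suc k) x = f (iter f k x)

-- i is the least element (w.r.t. toℕ) of its orbit under f.
-- For a permutation f of Fin n, the orbit of i is {f^k i | k < n}.
isOrbitMin : {n : ℕ} → (Fin n → Fin n) → Fin n → Bool
isOrbitMin {n} f i = all (λ k → toℕ i ≤ᵇ toℕ (iter f k i)) (upTo n)

-- cyc σ : number of cycles of σ (fixed points included) = number of orbits,
-- counted by their least elements.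
cyc : {n : ℕ} → (Fin n → Fin n) → ℕ
cyc {n} f = sum (map (λ i → if isOrbitMin f i then 1 else 0) (allFin n))

-- c^k where c = (1 2 … n) is the n-cycle i ↦ i+1 (mod n), on Fin n = {0,…,n-1}.
rotPow : (n : ℕ) → ℕ → Fin n → Fin n
rotPow (suc m) k i = (toℕ i + k) mod (suc m)

-- n - cyc(π ∘ c^k): minimum number of transpositions to write π c^k
swapDist : {n : ℕ} → Permutation′ n → ℕ → ℕ
swapDist {n} π k = n ∸ cyc (λ i → π ⟨$⟩ʳ rotPow n k i)

{-# OPTIONS --safe #-}
-- The rotations act transitively on the vertices, so some σ = π cᵏ fixes the
-- vertex 1. Then σ has the fixed point 1 as one cycle and the cycle through 0
-- as another, so cyc σ ≥ 2 and n − cyc σ ≤ n − 2.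
module Submission where

open import Defs
open import Data.Nat using (ℕ; zero; suc; _+_; _∸_; _≤_; _≤ᵇ_; s≤s; z≤n)
open import Data.Nat.Properties
  using (+-commutativeSemigroup; m+[n∸m]≡n; ∸-monoʳ-≤; ≤-refl; ≤⇒≤ᵇ)
open import Algebra.Properties.CommutativeSemigroup +-commutativeSemigroup using (x∙yz≈y∙xz)
open import Data.Nat.DivMod using (_mod_; _%_; %-distribˡ-+; m%n%n≡m%n; [m+n]%n≡m%n; m<n⇒m%n≡m)
open import Data.Fin using (Fin; zero; suc; toℕ)
open import Data.Fin.Properties using (toℕ-injective; toℕ-fromℕ<; toℕ<n; toℕ≤n)
open import Data.Fin.Permutation using (Permutation′; _⟨$⟩ʳ_; _⟨$⟩ˡ_; inverseʳ)
open import Data.Bool using (T)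
open import Data.Bool.Properties using (T-≡)
open import Data.List using (upTo)
open import Data.List.Relation.Unary.All using (universal)
open import Data.List.Relation.Unary.All.Properties using (all⁻)
open import Data.Product using (∃-syntax; _,_)
open import Function using (Equivalence)
open import Relation.Binary.PropositionalEquality
  using (_≡_; refl; sym; trans; cong; subst; module ≡-Reasoning)

iter-fixedPoint : {A : Set} (f : A → A) {x : A} → f x ≡ x → ∀ k → iter f k x ≡ x
iter-fixedPoint f fx≡x zero    = refl
iter-fixedPoint f fx≡x (suc k) = trans (cong f (iter-fixedPoint f fx≡x k)) fx≡x

isOrbitMin-zero : ∀ {n} (f : Fin (suc n) → Fin (suc n)) → T (isOrbitMin f zero)
isOrbitMin-zero {n} f = all⁻ (λ k → 0 ≤ᵇ toℕ (iter f k zero)) (universal _ (upTo (suc n)))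

isOrbitMin-fixedPoint : ∀ {n} (f : Fin n → Fin n) {i : Fin n} → f i ≡ i → T (isOrbitMin f i)
isOrbitMin-fixedPoint {n} f {i} fi≡i =
  all⁻ (λ k → toℕ i ≤ᵇ toℕ (iter f k i)) (universal i≤fᵏi (upTo n))
  where
  i≤fᵏi : ∀ k → T (toℕ i ≤ᵇ toℕ (iter f k i))
  i≤fᵏi k = subst (λ j → T (toℕ i ≤ᵇ toℕ j)) (sym (iter-fixedPoint f fi≡i k)) (≤⇒≤ᵇ (≤-refl {toℕ i}))

-- The first two summands of cyc f are the indicators of 0 and 1.
isOrbitMin-one⇒2≤cyc : ∀ {m} (f : Fin (suc (suc m)) → Fin (suc (suc m))) →
                       T (isOrbitMin f (suc zero)) → 2 ≤ cyc f
isOrbitMin-one⇒2≤cyc f min₁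
  rewrite Equivalence.to T-≡ (isOrbitMin-zero f) | Equivalence.to T-≡ min₁ = s≤s (s≤s z≤n)

rotPow-transitive : ∀ {n} (i j : Fin n) → ∃[ k ] rotPow n (toℕ {n} k) i ≡ j
rotPow-transitive {suc n-1} i j = k , toℕ-injective (begin
    toℕ ((toℕ i + toℕ k) mod n)         ≡⟨ toℕ-fromℕ< _ ⟩
    (toℕ i + toℕ k) % n                 ≡⟨ cong (λ x → (toℕ i + x) % n) (toℕ-fromℕ< _) ⟩
    (toℕ i + d % n) % n                 ≡⟨ %-distribˡ-+ (toℕ i) (d % n) n ⟩
    (toℕ i % n + d % n % n) % n         ≡⟨ cong (λ x → (toℕ i % n + x) % n) (m%n%n≡m%n d n) ⟩
    (toℕ i % n + d % n) % n             ≡⟨ %-distribˡ-+ (toℕ i) d n ⟨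
    (toℕ i + d) % n                     ≡⟨ cong (_% n) i+d≡j+n ⟩
    (toℕ j + n) % n                     ≡⟨ [m+n]%n≡m%n (toℕ j) n ⟩
    toℕ j % n                           ≡⟨ m<n⇒m%n≡m (toℕ<n j) ⟩
    toℕ j                               ∎)
  where
  open ≡-Reasoning
  n : ℕ
  n = suc n-1
  -- the rotation by j − i, shifted by n so that the subtraction does not truncate
  d : ℕ
  d = toℕ j + (n ∸ toℕ i)
  k : Fin n
  k = d mod n
  i+d≡j+n : toℕ i + d ≡ toℕ j + n
  i+d≡j+n = trans (x∙yz≈y∙xz (toℕ i) (toℕ j) _) (cong (toℕ j +_) (m+[n∸m]≡n (toℕ≤n i)))

mainTheorem4 : (n : ℕ) → 2 ≤ n → (π : Permutation′ n) →
    ∃[ k ] (swapDist π (toℕ {n} k) ≤ n ∸ 2)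
mainTheorem4 n@(suc (suc _)) (s≤s (s≤s _)) π with rotPow-transitive (suc zero) (π ⟨$⟩ˡ suc zero)
... | k , cᵏ1≡π⁻¹1 = k , ∸-monoʳ-≤ n (isOrbitMin-one⇒2≤cyc σ (isOrbitMin-fixedPoint σ σ1≡1))
  where
  σ : Fin n → Fin n
  σ i = π ⟨$⟩ʳ rotPow n (toℕ k) i
  σ1≡1 : σ (suc zero) ≡ suc zero
  σ1≡1 = trans (cong (π ⟨$⟩ʳ_) cᵏ1≡π⁻¹1) (inverseʳ π)
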